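{- Every $3$-degenerate claw-free graph $G$ is equitable list point $k$-arborable for every integer $k\geq \max\{\lceil (\Delta(G)+1)/2\rceil,3\}$, where $\Delta(G)$ is the maximum degree of $G$.
   Context: All graphs are finite, simple and undirected. A graph is $d$-degenerate if every subgraph of it has a vertex of degree at most $d$. A graph is claw-free if it has no induced subgraph isomorphic to $K_{1,3}$. A $k$-list assignment of a graph $G$ assigns to each vertex $v$ a set (list) $L(v)$ of $k$ colors. A graph $G$ is equitable list point $k$-arborable if for every $k$-list assignment $L$ one can choose $c(v)\in L(v)$ for each vertex $v$ such that each color class induces an acyclic subgraph (a forest) of $G$ and each color appears on at most $\lceil |V(G)|/k\rceil$ vertices of $G$. -}

module Defs where

open import Data.Nat using (ℕ; zero; suc; _+_; _≤_; _⊔_; _/_; ⌈_/2⌉; _≡ᵇ_)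
open import Data.Bool using (Bool; true; false; if_then_else_)
open import Data.Fin using (Fin; zero; suc; fromℕ; inject₁)
open import Data.Product using (Σ; _×_; ∃)
open import Data.List using (List; length)
open import Data.List.Membership.Propositional using (_∈_)
open import Data.List.Relation.Unary.Unique.Propositional using (Unique)
open import Function.Definitions using (Injective)
open import Relation.Binary.PropositionalEquality using (_≡_; _≢_)
open import Relation.Nullary using (¬_)

record Graph (n : ℕ) : Set where
  field
    adj    : Fin n → Fin n → Bool
    sym    : ∀ u v → adj u v ≡ adj v u
    irrefl : ∀ v → adj v v ≡ false
open Graph public

count : ∀ {n} → (Fin n → Bool) → ℕ
count {zero}  f = 0
count {suc n} f = (if f zero then 1 else 0) + count (λ i → f (suc i))

maxOver : ∀ {n} → (Fin n → ℕ) → ℕ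
maxOver {zero}  f = 0
maxOver {suc n} f = f zero ⊔ maxOver (λ i → f (suc i))

degree : ∀ {n} → Graph n → Fin n → ℕ
degree G v = count (adj G v)

Δ : ∀ {n} → Graph n → ℕ
Δ G = maxOver (degree G)

-- A subgraph of G: vertex set S (nonempty required separately) and a symmetric
-- edge set E contained in the edges of G with both ends in S.
record Subgraph {n : ℕ} (G : Graph n) : Set where
  field
    S     : Fin n → Bool
    E     : Fin n → Fin n → Bool
    E-sym : ∀ u v → E u v ≡ E v u
    E⊆G   : ∀ u v → E u v ≡ true → adj G u v ≡ true
    E⊆S   : ∀ u v → E u v ≡ true → S u ≡ true
open Subgraph public

subDegree : ∀ {n} {G : Graph n} → Subgraph G → Fin n → ℕ
subDegree H v = count (E H v)

Degenerate : ∀ {n} → ℕ → Graph n → Set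
Degenerate d G = (H : Subgraph G) → ∃ (λ v → S H v ≡ true) →
                 ∃ (λ v → S H v ≡ true × subDegree H v ≤ d)

ClawFree : ∀ {n} → Graph n → Set
ClawFree G = ¬ (Σ _ λ v → Σ _ λ a → Σ _ λ b → Σ _ λ c →
  adj G v a ≡ true × adj G v b ≡ true × adj G v c ≡ true ×
  a ≢ b × a ≢ c × b ≢ c ×
  adj G a b ≡ false × adj G a c ≡ false × adj G b c ≡ false)

-- a cycle of length m+3 in G whose vertices all lie in the vertex set S
record CycleIn {n : ℕ} (G : Graph n) (S : Fin n → Bool) : Set where
  field
    m      : ℕ
    f      : Fin (suc (suc (suc m))) → Fin n
    f-inj  : Injective _≡_ _≡_ f
    inS    : ∀ i → S (f i) ≡ true
    step   : ∀ (i : Fin (suc (suc m))) → adj G (f (inject₁ i)) (f (suc i)) ≡ true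
    close  : adj G (f (fromℕ (suc (suc m)))) (f zero) ≡ true

InducesForest : ∀ {n} → Graph n → (Fin n → Bool) → Set
InducesForest G S = ¬ CycleIn G S

-- ⌈ a / b ⌉ (with the irrelevant convention ⌈a/0⌉ = 0)
ceilDiv : ℕ → ℕ → ℕ
ceilDiv a zero    = 0
ceilDiv a (suc b) = (a + b) / suc b

ListAssignment : ℕ → ℕ → Set
ListAssignment n k = Σ (Fin n → List ℕ) λ L → ∀ v → Unique (L v) × length (L v) ≡ k

EquitableListPointArborable : ∀ {n} → Graph n → ℕ → Set
EquitableListPointArborable {n} G k =
  (LA : ListAssignment n k) →
  Σ (Fin n → ℕ) λ c →
    (∀ v → c v ∈ Σ.proj₁ LA v) ×
    (∀ (i : ℕ) → InducesForest G (λ v → c v ≡ᵇ i)) ×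
    (∀ (i : ℕ) → count (λ v → c v ≡ᵇ i) ≤ ceilDiv n k)

-- Colour the vertices block by block.  If U has at least k vertices, 3-degeneracy gives a
-- vertex v with at most three neighbours in U, and by claw-freeness three such neighbours
-- contain an edge xy.  A block consists of at most two neighbours of v (x and y when v has
-- three), vertices of degree at most 3, and finally v, ordered so that its vertex in position t
-- has fewer than 2(k − t) neighbours in U outside the block; Δ < 2k, which is what
-- k ≥ ⌈(Δ + 1)/2⌉ says, pays for the first two.  The rest of U is coloured by induction and the
-- block then greedily: charging 2 to each colour already used in the block and 1 to each colour
-- on an outside neighbour, the total charge is below 2k, so one of the k listed colours costs
-- at most 1.  That colour is new to the block and occurs on at most one neighbour of the vertex,
-- so its class stays a forest, and every colour class grows by at most one vertex per block.

module Submission where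

open import Defs renaming (sym to adj-sym)
open import Data.Nat
  using (ℕ; zero; suc; _+_; _*_; _≤_; _<_; _⊔_; _/_; ⌊_/2⌋; ⌈_/2⌉; _≡ᵇ_; _≤?_; z≤n; s≤s; s≤s⁻¹)
open import Data.Nat.Properties
open import Data.Nat.DivMod using (+-distrib-/-∣ʳ; n/n≡1; m≥n⇒m/n>0)
open import Data.Nat.Divisibility using (∣-refl)
open import Data.Nat.Induction using (<-rec)
open import Data.Nat.Tactic.RingSolver using (solve-∀)
open import Algebra.Properties.CommutativeSemigroup +-commutativeSemigroup
  using () renaming (interchange to +-interchange)
open import Data.Bool using (Bool; true; false; T; if_then_else_; _∧_; _∨_; not)
open import Data.Bool.Properties
  using (not-involutive; ∧-identityʳ; ∧-inverseʳ; ∧-zeroʳ; ∨-identityʳ; ∨-zeroʳ; ∨-assoc)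
open import Data.Fin using (Fin; zero; suc; fromℕ; inject₁; toℕ)
open import Data.Fin.Properties using (toℕ-inject₁; any?) renaming (_≟_ to _≟ᶠ_)
open import Data.Fin.Relation.Unary.Top using (view; ‵fromℕ; ‵inj₁)
open import Data.Product using (Σ; _×_; _,_; ∃; proj₁; proj₂)
open import Data.Sum using (_⊎_; inj₁; inj₂)
open import Data.Empty using (⊥; ⊥-elim)
open import Data.Unit using (⊤; tt)
open import Data.List using (List; []; _∷_; length; _++_; map)
open import Data.Nat.ListAction using (sum)
open import Data.List.Properties using (length-++)
open import Data.List.Membership.Propositional using (_∈_)
open import Data.List.Relation.Unary.All using (All; []; _∷_)
open import Data.List.Relation.Unary.Any using (here; there)
open import Data.List.Relation.Unary.AllPairs using ([]; _∷_)
open import Data.List.Relation.Unary.Unique.Propositional using (Unique)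
open import Relation.Binary.PropositionalEquality
open import Relation.Nullary using (yes; no)

_==_ : ∀ {n} → Fin n → Fin n → Bool
zero  == zero  = true
zero  == suc _ = false
suc _ == zero  = false
suc a == suc b = a == b

==-refl : ∀ {n} (a : Fin n) → (a == a) ≡ true
==-refl zero    = refl
==-refl (suc a) = ==-refl a

==⇒≡ : ∀ {n} (a b : Fin n) → (a == b) ≡ true → a ≡ b
==⇒≡ zero    zero    _ = refl
==⇒≡ (suc a) (suc b) e = cong suc (==⇒≡ a b e)

≢⇒==-false : ∀ {n} (a b : Fin n) → a ≢ b → (a == b) ≡ false
≢⇒==-false a b a≢b with a == b in e
... | true  = ⊥-elim (a≢b (==⇒≡ a b e))
... | false = refl

true≢false : ∀ {x} → x ≡ true → x ≡ false → ⊥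
true≢false refl ()

∧-elim : ∀ {x y} → x ∧ y ≡ true → x ≡ true × y ≡ true
∧-elim {true} {true} _ = refl , refl

∧-intro : ∀ {x y} → x ≡ true → y ≡ true → x ∧ y ≡ true
∧-intro refl refl = refl

∨-elim : ∀ {x y} → x ∨ y ≡ true → x ≡ true ⊎ y ≡ true
∨-elim {true}  _ = inj₁ refl
∨-elim {false} e = inj₂ e

∨-introˡ : ∀ {x y} → x ≡ true → x ∨ y ≡ true
∨-introˡ refl = refl

∨-introʳ : ∀ {x y} → y ≡ true → x ∨ y ≡ true
∨-introʳ {true}  _ = refl
∨-introʳ {false} e = e

≡ᵇ⇒≡′ : ∀ x b → (x ≡ᵇ b) ≡ true → x ≡ b
≡ᵇ⇒≡′ x b e = ≡ᵇ⇒≡ x b (subst T (sym e) _)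

≢⇒≡ᵇ-false : ∀ x b → x ≢ b → (x ≡ᵇ b) ≡ false
≢⇒≡ᵇ-false x b x≢b with x ≡ᵇ b in e
... | false = refl
... | true  = ⊥-elim (x≢b (≡ᵇ⇒≡′ x b e))

iverson : Bool → ℕ
iverson b = if b then 1 else 0

sumFin : ∀ {n} → (Fin n → ℕ) → ℕ
sumFin {zero}  f = 0
sumFin {suc n} f = f zero + sumFin (λ i → f (suc i))

count≡sumFin : ∀ {n} (f : Fin n → Bool) → count f ≡ sumFin (λ v → iverson (f v))
count≡sumFin {zero}  f = refl
count≡sumFin {suc n} f = cong (iverson (f zero) +_) (count≡sumFin (λ i → f (suc i)))

sumFin-0 : ∀ {n} → sumFin {n} (λ _ → 0) ≡ 0
sumFin-0 {zero}  = refl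
sumFin-0 {suc n} = sumFin-0 {n}

sumFin-mono-≤ : ∀ {n} {f g : Fin n → ℕ} → (∀ v → f v ≤ g v) → sumFin f ≤ sumFin g
sumFin-mono-≤ {zero}  h = z≤n
sumFin-mono-≤ {suc n} h = +-mono-≤ (h zero) (sumFin-mono-≤ (λ i → h (suc i)))

sumFin-+ : ∀ {n} (f g : Fin n → ℕ) → sumFin (λ v → f v + g v) ≡ sumFin f + sumFin g
sumFin-+ {zero}  f g = refl
sumFin-+ {suc n} f g =
  trans (cong (f zero + g zero +_) (sumFin-+ (λ i → f (suc i)) (λ i → g (suc i))))
        (+-interchange (f zero) (g zero) _ _)

≤-sumFin : ∀ {n} (f : Fin n → ℕ) p → f p ≤ sumFin f
≤-sumFin f zero    = m≤m+n _ _
≤-sumFin f (suc p) = ≤-trans (≤-sumFin (λ i → f (suc i)) p) (m≤n+m _ _)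

+≤-sumFin : ∀ {n} (f : Fin n → ℕ) p q → p ≢ q → f p + f q ≤ sumFin f
+≤-sumFin f zero    zero    p≢q = ⊥-elim (p≢q refl)
+≤-sumFin f zero    (suc q) _   = +-monoʳ-≤ (f zero) (≤-sumFin (λ i → f (suc i)) q)
+≤-sumFin f (suc p) zero    _   = subst (_≤ sumFin f) (+-comm (f zero) (f (suc p)))
  (+-monoʳ-≤ (f zero) (≤-sumFin (λ i → f (suc i)) p))
+≤-sumFin f (suc p) (suc q) p≢q =
  ≤-trans (+≤-sumFin (λ i → f (suc i)) p q (λ e → p≢q (cong suc e))) (m≤n+m _ _)

maxOver-upper : ∀ {n} (f : Fin n → ℕ) i → f i ≤ maxOver f
maxOver-upper f zero    = m≤m⊔n _ _
maxOver-upper f (suc i) = ≤-trans (maxOver-upper (λ j → f (suc j)) i) (m≤n⊔m _ _)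

ceilDiv-+-self : ∀ r d → ceilDiv (r + suc d) (suc d) ≡ suc (ceilDiv r (suc d))
ceilDiv-+-self r d = begin
  (r + suc d + d) / suc d         ≡⟨ cong (_/ suc d) (reorder r d) ⟩
  (r + d + suc d) / suc d         ≡⟨ +-distrib-/-∣ʳ (r + d) ∣-refl ⟩
  (r + d) / suc d + suc d / suc d ≡⟨ cong ((r + d) / suc d +_) (n/n≡1 (suc d)) ⟩
  (r + d) / suc d + 1             ≡⟨ +-comm _ 1 ⟩
  suc ((r + d) / suc d)           ∎
  where
  open ≡-Reasoning
  reorder : ∀ r d → r + suc d + d ≡ r + d + suc d
  reorder = solve-∀

ceilDiv-pos : ∀ m d → 1 ≤ ceilDiv (suc m) (suc d)
ceilDiv-pos m d = m≥n⇒m/n>0 {suc m + d} {suc d} (s≤s (m≤n+m d m))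

⌈n/2⌉≤k⇒n≤k+k : ∀ {n k} → ⌈ n /2⌉ ≤ k → n ≤ k + k
⌈n/2⌉≤k⇒n≤k+k {n} {k} half≤k = begin
  n                 ≡⟨ sym (⌊n/2⌋+⌈n/2⌉≡n n) ⟩
  ⌊ n /2⌋ + ⌈ n /2⌉ ≤⟨ +-mono-≤ (≤-trans (⌊n/2⌋≤⌈n/2⌉ n) half≤k) half≤k ⟩
  k + k             ∎
  where open ≤-Reasoning

count-cong : ∀ {n} {f g : Fin n → Bool} → (∀ v → f v ≡ g v) → count f ≡ count g
count-cong {zero}  h = refl
count-cong {suc n} {f} {g} h rewrite h zero = cong (iverson (g zero) +_) (count-cong (λ i → h (suc i)))

count-mono : ∀ {n} {f g : Fin n → Bool} → (∀ v → f v ≡ true → g v ≡ true) → count f ≤ count g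
count-mono {zero}  h = z≤n
count-mono {suc n} {f} h with f zero in e
... | true rewrite h zero e = s≤s (count-mono (λ i → h (suc i)))
... | false = ≤-trans (count-mono (λ i → h (suc i))) (m≤n+m _ _)

count-false : ∀ {n} → count {n} (λ _ → false) ≡ 0
count-false {zero}  = refl
count-false {suc n} = count-false {n}

count-true : ∀ {n} → count {n} (λ _ → true) ≡ n
count-true {zero}  = refl
count-true {suc n} = cong suc (count-true {n})

count-∨ : ∀ {n} (f g : Fin n → Bool) → count (λ v → f v ∨ g v) ≤ count f + count g
count-∨ {zero} f g = z≤n
count-∨ {suc n} f g with f zero | g zero | count-∨ (λ i → f (suc i)) (λ i → g (suc i))
... | true  | true  | ih = s≤s (≤-trans ih (+-monoʳ-≤ (count (λ i → f (suc i))) (n≤1+n _)))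
... | true  | false | ih = s≤s ih
... | false | true  | ih = ≤-trans (s≤s ih) (≤-reflexive (sym (+-suc _ _)))
... | false | false | ih = ih

_∖_ : ∀ {n} → (Fin n → Bool) → Fin n → (Fin n → Bool)
(f ∖ x) v = f v ∧ not (v == x)

∖-elim : ∀ {n} (f : Fin n → Bool) u x → (f ∖ x) u ≡ true → f u ≡ true × u ≢ x
∖-elim f u x e with ∧-elim {f u} e
... | fu , u≢x = fu , λ { refl → true≢false u≢x (cong not (==-refl u)) }

count-∖ : ∀ {n} (f : Fin n → Bool) x → f x ≡ true → count f ≡ suc (count (f ∖ x))
count-∖ {suc n} f zero e rewrite e = cong suc (count-cong (λ i → sym (∧-identityʳ (f (suc i)))))
count-∖ {suc n} f (suc x) e with f zero
... | true  = cong suc (count-∖ (λ i → f (suc i)) x e)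
... | false = count-∖ (λ i → f (suc i)) x e

count≡0⇒false : ∀ {n} (f : Fin n → Bool) → count f ≡ 0 → ∀ x → f x ≡ false
count≡0⇒false f c x with f x in e
... | false = refl
... | true with () ← trans (sym c) (count-∖ f x e)

count>0⇒∃ : ∀ {n} (f : Fin n → Bool) → 1 ≤ count f → ∃ λ x → f x ≡ true
count>0⇒∃ {suc n} f c with f zero in e
... | true  = zero , e
... | false with count>0⇒∃ (λ i → f (suc i)) c
... | x , fx = suc x , fx

count-== : ∀ {n} (y : Fin n) → count (λ v → v == y) ≡ 1
count-== {n} y = trans (count-∖ _ y (==-refl y))
  (cong suc (trans (count-cong (λ v → ∧-inverseʳ (v == y))) (count-false {n})))

insert : ∀ {n} → (Fin n → Bool) → Fin n → (Fin n → Bool)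
insert f x v = f v ∨ (v == x)

count-insert : ∀ {n} (f : Fin n → Bool) x → f x ≡ false → count (insert f x) ≡ suc (count f)
count-insert f x fx = trans (count-∖ _ x (∨-introʳ {f x} (==-refl x))) (cong suc (count-cong removed))
  where
  removed : ∀ u → (insert f x ∖ x) u ≡ f u
  removed u with u == x in e
  ... | true  rewrite ==⇒≡ u x e | fx = refl
  ... | false = trans (∧-identityʳ _) (∨-identityʳ (f u))

_∈ᵇ_ : ∀ {n} → Fin n → List (Fin n) → Bool
u ∈ᵇ []       = false
u ∈ᵇ (y ∷ ys) = (u == y) ∨ (u ∈ᵇ ys)

∈ᵇ-here : ∀ {n} (y : Fin n) ys → (y ∈ᵇ (y ∷ ys)) ≡ true
∈ᵇ-here y ys = ∨-introˡ (==-refl y)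

∈ᵇ-++ : ∀ {n} (u : Fin n) xs ys → (u ∈ᵇ (xs ++ ys)) ≡ (u ∈ᵇ xs) ∨ (u ∈ᵇ ys)
∈ᵇ-++ u []       ys = refl
∈ᵇ-++ u (x ∷ xs) ys rewrite ∈ᵇ-++ u xs ys = sym (∨-assoc (u == x) (u ∈ᵇ xs) (u ∈ᵇ ys))

∈ᵇ-++⁺ˡ : ∀ {n} {u : Fin n} xs ys → (u ∈ᵇ xs) ≡ true → (u ∈ᵇ (xs ++ ys)) ≡ true
∈ᵇ-++⁺ˡ {u = u} xs ys m = trans (∈ᵇ-++ u xs ys) (∨-introˡ m)

∈ᵇ-++⁺ʳ : ∀ {n} {u : Fin n} xs ys → (u ∈ᵇ ys) ≡ true → (u ∈ᵇ (xs ++ ys)) ≡ true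
∈ᵇ-++⁺ʳ {u = u} xs ys m = trans (∈ᵇ-++ u xs ys) (∨-introʳ {u ∈ᵇ xs} m)

∈ᵇ-singleton : ∀ {n} {u y : Fin n} → (u ∈ᵇ (y ∷ [])) ≡ true → u ≡ y
∈ᵇ-singleton {u = u} {y} m = ==⇒≡ u y (trans (sym (∨-identityʳ (u == y))) m)

Distinct : ∀ {n} → List (Fin n) → Set
Distinct []       = ⊤
Distinct (y ∷ ys) = (y ∈ᵇ ys) ≡ false × Distinct ys

Distinct-++ : ∀ {n} (xs ys : List (Fin n)) → Distinct xs → Distinct ys →
              (∀ u → (u ∈ᵇ xs) ≡ true → (u ∈ᵇ ys) ≡ false) → Distinct (xs ++ ys)
Distinct-++ []       ys _ dys _ = dys
Distinct-++ (x ∷ xs) ys (x∉xs , dxs) dys disj =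
  trans (∈ᵇ-++ x xs ys) (subst (λ b → b ∨ (x ∈ᵇ ys) ≡ false) (sym x∉xs) (disj x (∈ᵇ-here x xs))) ,
  Distinct-++ xs ys dxs dys (λ u m → disj u (∨-introʳ m))

_∖ₗ_ : ∀ {n} → (Fin n → Bool) → List (Fin n) → Fin n → Bool
(X ∖ₗ zs) u = X u ∧ not (u ∈ᵇ zs)

_⊆ˡ_ : ∀ {n} → List (Fin n) → (Fin n → Bool) → Set
zs ⊆ˡ X = ∀ z → (z ∈ᵇ zs) ≡ true → X z ≡ true

_⊆ₗ_ : ∀ {n} → List (Fin n) → List (Fin n) → Set
xs ⊆ₗ ys = xs ⊆ˡ (λ u → u ∈ᵇ ys)

∖ₗ-⊆ : ∀ {n} {X X′ : Fin n → Bool} xs ys → (∀ u → X u ≡ true → X′ u ≡ true) → ys ⊆ₗ xs →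
       ∀ u → (X ∖ₗ xs) u ≡ true → (X′ ∖ₗ ys) u ≡ true
∖ₗ-⊆ {X = X} xs ys X⊆X′ ys⊆xs u h with ∧-elim {X u} h | u ∈ᵇ ys in e
... | Xu , _    | false = ∧-intro (X⊆X′ u Xu) refl
... | _  , u∉xs | true  = ⊥-elim (true≢false (ys⊆xs u e) (trans (sym (not-involutive _)) (cong not u∉xs)))

∖ₗ-∷ : ∀ {n} (X : Fin n → Bool) z zs u → (X ∖ₗ (z ∷ zs)) u ≡ ((X ∖ z) ∖ₗ zs) u
∖ₗ-∷ X z zs u with X u | u == z
... | true  | true  = refl
... | true  | false = refl
... | false | _     = refl

∖ₗ-++ : ∀ {n} (X : Fin n → Bool) xs ys u → ((X ∖ₗ xs) ∖ₗ ys) u ≡ (X ∖ₗ (xs ++ ys)) u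
∖ₗ-++ X xs ys u rewrite ∈ᵇ-++ u xs ys with X u | u ∈ᵇ xs
... | true  | true  = refl
... | true  | false = refl
... | false | _     = refl

count-∖ₗ : ∀ {n} (X : Fin n → Bool) (zs : List (Fin n)) → Distinct zs →
           zs ⊆ˡ X → count (X ∖ₗ zs) + length zs ≡ count X
count-∖ₗ X [] _ _ = trans (+-identityʳ _) (count-cong (λ u → ∧-identityʳ (X u)))
count-∖ₗ X (z ∷ zs) (z∉zs , dzs) zs⊆X = begin
  count (X ∖ₗ (z ∷ zs)) + suc (length zs) ≡⟨ +-suc _ _ ⟩
  suc (count (X ∖ₗ (z ∷ zs)) + length zs) ≡⟨ cong (λ c → suc (c + length zs)) (count-cong (∖ₗ-∷ X z zs)) ⟩
  suc (count ((X ∖ z) ∖ₗ zs) + length zs) ≡⟨ cong suc (count-∖ₗ (X ∖ z) zs dzs zs⊆X∖z) ⟩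
  suc (count (X ∖ z))                     ≡⟨ sym (count-∖ X z (zs⊆X z (∈ᵇ-here z zs))) ⟩
  count X                                 ∎
  where
  open ≡-Reasoning
  zs⊆X∖z : ∀ w → (w ∈ᵇ zs) ≡ true → (X ∖ z) w ≡ true
  zs⊆X∖z w m with w == z in e
  ... | true  = ⊥-elim (true≢false (subst (λ q → (q ∈ᵇ zs) ≡ true) (==⇒≡ w z e) m) z∉zs)
  ... | false = trans (∧-identityʳ (X w)) (zs⊆X w (∨-introʳ m))

module _ {n : ℕ} (G : Graph n) where

  adj-flip : ∀ {u v} → adj G u v ≡ true → adj G v u ≡ true
  adj-flip {u} {v} e = trans (adj-sym G v u) e

  degreeIn : (Fin n → Bool) → Fin n → ℕ
  degreeIn R y = count (λ u → adj G y u ∧ R u)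

  degreeIn-mono : ∀ {R R′} → (∀ u → R′ u ≡ true → R u ≡ true) → ∀ y → degreeIn R′ y ≤ degreeIn R y
  degreeIn-mono R′⊆R y =
    count-mono (λ u h → ∧-intro (proj₁ (∧-elim {adj G y u} h)) (R′⊆R u (proj₂ (∧-elim {adj G y u} h))))

  degreeIn≤Δ : ∀ R y → degreeIn R y ≤ Δ G
  degreeIn≤Δ R y = ≤-trans (count-mono (λ u h → proj₁ (∧-elim {adj G y u} h))) (maxOver-upper (degree G) y)

  degreeIn-avoiding : ∀ {R S} ps y → Distinct ps → ps ⊆ˡ (λ u → adj G y u ∧ S u) →
                      (∀ u → R u ≡ true → (S ∖ₗ ps) u ≡ true) → degreeIn R y + length ps ≤ degreeIn S y
  degreeIn-avoiding {R} {S} ps y distinct ps⊆N R⊆S∖ps = begin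
    degreeIn R y + length ps                            ≤⟨ +-monoˡ-≤ (length ps) (count-mono R⊆N∖ps) ⟩
    count ((λ u → adj G y u ∧ S u) ∖ₗ ps) + length ps  ≡⟨ count-∖ₗ _ ps distinct ps⊆N ⟩
    degreeIn S y                                        ∎
    where
    open ≤-Reasoning
    R⊆N∖ps : ∀ u → adj G y u ∧ R u ≡ true → ((λ u → adj G y u ∧ S u) ∖ₗ ps) u ≡ true
    R⊆N∖ps u h with ∧-elim {adj G y u} h
    ... | yu , Ru with ∧-elim {S u} (R⊆S∖ps u Ru)
    ... | Su , u∉ps = ∧-intro (∧-intro yu Su) u∉ps

  adj⇒≢ : ∀ {u v} → adj G u v ≡ true → u ≢ v
  adj⇒≢ {u} e refl = true≢false e (irrefl G u)

  module _ {S : Fin n → Bool} (C : CycleIn G S) where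
    open CycleIn C

    cycle-within : ∀ {S′} → (∀ i → S′ (f i) ≡ true) → CycleIn G S′
    cycle-within onS′ = record { m = m ; f = f ; f-inj = f-inj ; inS = onS′ ; step = step ; close = close }

    cycle-neighbours : ∀ j → Σ _ λ p → Σ _ λ q → p ≢ q × adj G (f j) (f p) ≡ true × adj G (f j) (f q) ≡ true
    cycle-neighbours j with view j
    ... | ‵fromℕ = inject₁ (fromℕ (suc m)) , zero , (λ ()) , adj-flip (step (fromℕ (suc m))) , close
    ... | ‵inj₁ {i = zero}   _ = suc zero , fromℕ (suc (suc m)) , (λ ()) , step zero , adj-flip close
    ... | ‵inj₁ {i = suc i′} _ =
      suc (suc i′) , inject₁ (inject₁ i′) , 2+≢inject₁² , step (suc i′) , adj-flip (step (inject₁ i′))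
      where
      2+≢inject₁² : suc (suc i′) ≢ inject₁ (inject₁ i′)
      2+≢inject₁² e = m≢1+n+m (toℕ i′) {1} (sym (begin
        suc (suc (toℕ i′))           ≡⟨ cong toℕ e ⟩
        toℕ (inject₁ (inject₁ i′))   ≡⟨ toℕ-inject₁ (inject₁ i′) ⟩
        toℕ (inject₁ i′)             ≡⟨ toℕ-inject₁ i′ ⟩
        toℕ i′                       ∎))
        where open ≡-Reasoning

  InducesForest-⊆ : {F F′ : Fin n → Bool} → (∀ v → F′ v ≡ true → F v ≡ true) →
                    InducesForest G F → InducesForest G F′
  InducesForest-⊆ F′⊆F forest C = forest (cycle-within C (λ i → F′⊆F _ (CycleIn.inS C i)))

  -- A cycle through y leaves y along two distinct edges, and both ends lie in F.
  InducesForest-addLeaf : (F : Fin n → Bool) (y : Fin n) → InducesForest G F →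
    (∀ p q → adj G y p ≡ true → F p ≡ true → adj G y q ≡ true → F q ≡ true → p ≡ q) →
    InducesForest G (insert F y)
  InducesForest-addLeaf F y forest atMostOne C with any? (λ j → CycleIn.f C j ≟ᶠ y)
  ... | no y∉C = forest (cycle-within C inF)
    where
    open CycleIn C
    inF : ∀ i → F (f i) ≡ true
    inF i with ∨-elim (inS i)
    ... | inj₁ Ffi = Ffi
    ... | inj₂ fi=y = ⊥-elim (y∉C (i , ==⇒≡ _ _ fi=y))
  ... | yes (j , fj≡y) with cycle-neighbours C j
  ... | p , q , p≢q , adj-p , adj-q =
    p≢q (f-inj (atMostOne _ _ (y-adj adj-p) (inF p adj-p) (y-adj adj-q) (inF q adj-q)))
    where
    open CycleIn C
    y-adj : ∀ {u} → adj G (f j) u ≡ true → adj G y u ≡ true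
    y-adj = subst (λ w → adj G w _ ≡ true) fj≡y
    inF : ∀ i → adj G (f j) (f i) ≡ true → F (f i) ≡ true
    inF i a with ∨-elim (inS i)
    ... | inj₁ Ffi = Ffi
    ... | inj₂ fi=y = ⊥-elim (adj⇒≢ (y-adj a) (sym (==⇒≡ _ _ fi=y)))

-- Choosing a colour by a weighted pigeonhole

sum-map-sumFin : ∀ {n} (ls : List ℕ) (h : ℕ → Fin n → ℕ) →
                 sum (map (λ a → sumFin (h a)) ls) ≡ sumFin (λ u → sum (map (λ a → h a u) ls))
sum-map-sumFin {n} [] h = sym (sumFin-0 {n})
sum-map-sumFin (a ∷ as) h = trans (cong (sumFin (h a) +_) (sum-map-sumFin as h)) (sym (sumFin-+ (h a) _))

sum-map-≡ᵇ-absent : ∀ w a bs → All (a ≢_) bs → sum (map (λ b → if a ≡ᵇ b then w else 0) bs) ≡ 0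
sum-map-≡ᵇ-absent w a []       []           = refl
sum-map-≡ᵇ-absent w a (b ∷ bs) (a≢b ∷ a∉bs) rewrite ≢⇒≡ᵇ-false a b a≢b = sum-map-≡ᵇ-absent w a bs a∉bs

sum-map-≡ᵇ-≤ : ∀ x w (ls : List ℕ) → Unique ls → sum (map (λ a → if x ≡ᵇ a then w else 0) ls) ≤ w
sum-map-≡ᵇ-≤ x w []       []         = z≤n
sum-map-≡ᵇ-≤ x w (a ∷ as) (a∉as ∷ u) with x ≡ᵇ a in e
... | true  rewrite ≡ᵇ⇒≡′ x a e | sum-map-≡ᵇ-absent w a as a∉as = ≤-reflexive (+-identityʳ w)
... | false = sum-map-≡ᵇ-≤ x w as u

light-or-heavy : (g : ℕ → ℕ) (ls : List ℕ) →
                 (Σ ℕ λ a → a ∈ ls × g a ≤ 1) ⊎ (2 * length ls ≤ sum (map g ls))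
light-or-heavy g [] = inj₂ z≤n
light-or-heavy g (a ∷ as) with g a ≤? 1 | light-or-heavy g as
... | yes light | _                   = inj₁ (a , here refl , light)
... | no  _     | inj₁ (b , b∈ , light) = inj₁ (b , there b∈ , light)
... | no  heavy | inj₂ heavyAll       =
  inj₂ (≤-trans (≤-reflexive (*-distribˡ-+ 2 1 (length as))) (+-mono-≤ (≰⇒> heavy) heavyAll))

colourWeight : ∀ {n} → (Fin n → ℕ) → (Fin n → ℕ) → ℕ → ℕ
colourWeight col ω a = sumFin (λ u → if col u ≡ᵇ a then ω u else 0)

-- Pigeonhole: each vertex's weight is charged to at most one colour of the list.
light-colour : ∀ {n} (ls : List ℕ) → Unique ls → (col ω : Fin n → ℕ) → sumFin ω < length ls + length ls →
               Σ ℕ λ a → a ∈ ls × colourWeight col ω a ≤ 1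
light-colour ls u col ω total<2k with light-or-heavy (colourWeight col ω) ls
... | inj₁ light = light
... | inj₂ heavy = ⊥-elim (<⇒≱ total<2k (begin
  length ls + length ls                             ≡⟨ cong (length ls +_) (sym (+-identityʳ (length ls))) ⟩
  2 * length ls                                     ≤⟨ heavy ⟩
  sum (map (colourWeight col ω) ls)                 ≡⟨ sum-map-sumFin ls (λ a v → if col v ≡ᵇ a then ω v else 0) ⟩
  sumFin (λ v → sum (map (λ a → if col v ≡ᵇ a then ω v else 0) ls))
                                                    ≤⟨ sumFin-mono-≤ (λ v → sum-map-≡ᵇ-≤ (col v) (ω v) ls u) ⟩
  sumFin ω                                          ∎))
  where open ≤-Reasoning

module _ {n : ℕ} (G : Graph n) (R D : Fin n → Bool) (col : Fin n → ℕ) (y : Fin n) where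

  AtMostOneNeighbourColoured : ℕ → Set
  AtMostOneNeighbourColoured a = ∀ p q → adj G y p ≡ true → R p ≡ true → (col p ≡ᵇ a) ≡ true →
                                        adj G y q ≡ true → R q ≡ true → (col q ≡ᵇ a) ≡ true → p ≡ q

  -- Vertices of D weigh 2 and R-neighbours of y weigh 1, so a colour of weight at most 1
  -- is unused on D and used on at most one R-neighbour of y.
  good-colour : (ls : List ℕ) → Unique ls → count D + count D + degreeIn G R y < length ls + length ls →
                Σ ℕ λ a → a ∈ ls × (∀ u → D u ≡ true → (col u ≡ᵇ a) ≡ false) × AtMostOneNeighbourColoured a
  good-colour ls unique bound = a , a∈ls , unused-on-D , atMostOne
    where
    ω : Fin n → ℕ
    ω u = iverson (D u) + iverson (D u) + iverson (adj G y u ∧ R u)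
    total : sumFin ω ≡ count D + count D + degreeIn G R y
    total = begin
      sumFin ω
        ≡⟨ sumFin-+ (λ u → iverson (D u) + iverson (D u)) _ ⟩
      sumFin (λ u → iverson (D u) + iverson (D u)) + sumFin (λ u → iverson (adj G y u ∧ R u))
        ≡⟨ cong₂ _+_ (sumFin-+ (λ u → iverson (D u)) _) (sym (count≡sumFin (λ u → adj G y u ∧ R u))) ⟩
      sumFin (λ u → iverson (D u)) + sumFin (λ u → iverson (D u)) + degreeIn G R y
        ≡⟨ cong (λ c → c + c + degreeIn G R y) (sym (count≡sumFin D)) ⟩
      count D + count D + degreeIn G R y ∎
      where open ≡-Reasoning
    light = light-colour ls unique col ω (subst (_< length ls + length ls) (sym total) bound)
    a = proj₁ light
    a∈ls = proj₁ (proj₂ light)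
    weight≤1 : colourWeight col ω a ≤ 1
    weight≤1 = proj₂ (proj₂ light)
    term : ∀ u → (col u ≡ᵇ a) ≡ true → ω u ≤ colourWeight col ω a
    term u e = subst (_≤ colourWeight col ω a) (cong (λ b → if b then ω u else 0) e)
                     (≤-sumFin (λ v → if col v ≡ᵇ a then ω v else 0) u)
    unused-on-D : ∀ u → D u ≡ true → (col u ≡ᵇ a) ≡ false
    unused-on-D u Du with col u ≡ᵇ a in e
    ... | false = refl
    ... | true with ≤-trans (term u e) weight≤1
    ... | ω≤1 rewrite Du with ω≤1
    ... | s≤s ()
    neighbour-weight : ∀ p → adj G y p ≡ true → R p ≡ true → 1 ≤ ω p
    neighbour-weight p yp Rp rewrite yp | Rp = m≤n+m 1 _
    atMostOne : AtMostOneNeighbourColoured a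
    atMostOne p q yp Rp cp yq Rq cq with p ≟ᶠ q
    ... | yes p≡q = p≡q
    ... | no p≢q = ⊥-elim (<⇒≱ (s≤s (s≤s z≤n)) (begin
      2                                       ≤⟨ +-mono-≤ (neighbour-weight p yp Rp) (neighbour-weight q yq Rq) ⟩
      ω p + ω q
        ≡⟨ cong₂ (λ b c → (if b then ω p else 0) + (if c then ω q else 0)) (sym cp) (sym cq) ⟩
      (if col p ≡ᵇ a then ω p else 0) + (if col q ≡ᵇ a then ω q else 0)
                                              ≤⟨ +≤-sumFin (λ v → if col v ≡ᵇ a then ω v else 0) p q p≢q ⟩
      colourWeight col ω a                    ≤⟨ weight≤1 ⟩
      1                                       ∎))
      where open ≤-Reasoning

-- Greedy extension of a colouring along a list

module _ {n : ℕ} (G : Graph n) (k : ℕ) where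

  -- The vertex in position t of the list has at most t coloured list predecessors, each of
  -- which must be avoided outright (weight 2), and degreeIn G R y neighbours in R (weight 1).
  GreedyOrder : (Fin n → Bool) → ℕ → List (Fin n) → Set
  GreedyOrder R t []       = ⊤
  GreedyOrder R t (y ∷ ys) = t + t + degreeIn G R y < k + k × GreedyOrder R (suc t) ys

  GreedyOrder-⊆ : ∀ {R R′} → (∀ u → R′ u ≡ true → R u ≡ true) →
                  ∀ t ys → GreedyOrder R t ys → GreedyOrder R′ t ys
  GreedyOrder-⊆ R′⊆R t []       _               = tt
  GreedyOrder-⊆ R′⊆R t (y ∷ ys) (slot , order) =
    ≤-<-trans (+-monoʳ-≤ (t + t) (degreeIn-mono G R′⊆R y)) slot , GreedyOrder-⊆ R′⊆R (suc t) ys order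

  GreedyOrder-++ : ∀ R t xs ys → GreedyOrder R t xs → GreedyOrder R (t + length xs) ys → GreedyOrder R t (xs ++ ys)
  GreedyOrder-++ R t []       ys _               order′ = subst (λ s → GreedyOrder R s ys) (+-identityʳ t) order′
  GreedyOrder-++ R t (x ∷ xs) ys (slot , order) order′ =
    slot , GreedyOrder-++ R (suc t) xs ys order (subst (λ s → GreedyOrder R s ys) (+-suc t (length xs)) order′)

  GreedyOrder-lowDegree : ∀ R zs t → (∀ z → (z ∈ᵇ zs) ≡ true → degreeIn G R z ≤ 3) → t + length zs < k →
                          GreedyOrder R t zs
  GreedyOrder-lowDegree R []       t _   _     = tt
  GreedyOrder-lowDegree R (z ∷ zs) t low fits =
    slot , GreedyOrder-lowDegree R zs (suc t) (λ w m → low w (∨-introʳ m)) fits′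
    where
    fits′ : suc t + length zs < k
    fits′ = subst (_< k) (+-suc t (length zs)) fits
    2+t≤k : 2 + t ≤ k
    2+t≤k = ≤-trans (s≤s (≤-trans (s≤s (m≤m+n t (length zs))) (≤-reflexive (sym (+-suc t (length zs)))))) fits
    slot : t + t + degreeIn G R z < k + k
    slot = begin-strict
      t + t + degreeIn G R z ≤⟨ +-monoʳ-≤ (t + t) (low z (∈ᵇ-here z zs)) ⟩
      t + t + 3              <⟨ ≤-reflexive (double-2+ t) ⟩
      (2 + t) + (2 + t)      ≤⟨ +-mono-≤ 2+t≤k 2+t≤k ⟩
      k + k                  ∎
      where
      open ≤-Reasoning
      double-2+ : ∀ t → suc (t + t + 3) ≡ (2 + t) + (2 + t)
      double-2+ = solve-∀

record Colouring {n : ℕ} (G : Graph n) {k : ℕ} (LA : ListAssignment n k) (X : Fin n → Bool) (β : ℕ) : Set where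
  field
    colour : Fin n → ℕ
    inList : ∀ u → X u ≡ true → colour u ∈ proj₁ LA u
    forest : ∀ a → InducesForest G (λ u → X u ∧ (colour u ≡ᵇ a))
    bound  : ∀ a → count (λ u → X u ∧ (colour u ≡ᵇ a)) ≤ β

recolour : ∀ {n} → (Fin n → ℕ) → Fin n → ℕ → Fin n → ℕ
recolour col y a u = if u == y then a else col u

module _ {n : ℕ} (G : Graph n) {k : ℕ} (LA : ListAssignment n k) (R : Fin n → Bool) (β : ℕ) where

  private
    L = proj₁ LA

  record PartialColouring (D : Fin n → Bool) (col : Fin n → ℕ) : Set where
    field
      inList   : ∀ u → R u ∨ D u ≡ true → col u ∈ L u
      forest   : ∀ a → InducesForest G (λ u → (R u ∨ D u) ∧ (col u ≡ᵇ a))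
      R-bound  : ∀ a → count (λ u → R u ∧ (col u ≡ᵇ a)) ≤ β
      D-bound  : ∀ a → count (λ u → D u ∧ (col u ≡ᵇ a)) ≤ 1
      disjoint : ∀ u → R u ≡ true → D u ≡ false
  open PartialColouring

  extend-vertex : ∀ D col y → count D + count D + degreeIn G R y < k + k → R y ≡ false → D y ≡ false →
                  PartialColouring D col → Σ (Fin n → ℕ) (PartialColouring (insert D y))
  extend-vertex D col y bound Ry Dy P = col′ , record
    { inList = inList′ ; forest = forest′ ; R-bound = R-bound′ ; D-bound = D-bound′ ; disjoint = disjoint′ }
    where
    good = good-colour G R D col y (L y) (proj₁ (proj₂ LA y))
             (subst (λ l → count D + count D + degreeIn G R y < l + l) (sym (proj₂ (proj₂ LA y))) bound)
    a = proj₁ good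
    a∈Ly = proj₁ (proj₂ good)
    unused-on-D = proj₁ (proj₂ (proj₂ good))
    atMostOne = proj₂ (proj₂ (proj₂ good))
    col′ = recolour col y a

    old : ∀ u → R u ∨ (D u ∨ false) ≡ true → R u ∨ D u ≡ true
    old u = subst (λ x → R u ∨ x ≡ true) (∨-identityʳ (D u))
    R≢y : ∀ u → R u ≡ true → (u == y) ≡ false
    R≢y u Ru = ≢⇒==-false u y (λ { refl → true≢false Ru Ry })

    inList′ : ∀ u → R u ∨ insert D y u ≡ true → col′ u ∈ L u
    inList′ u h with u == y in e
    ... | true  rewrite ==⇒≡ u y e = a∈Ly
    ... | false = inList P u (old u h)

    R-bound′ : ∀ b → count (λ u → R u ∧ (col′ u ≡ᵇ b)) ≤ β
    R-bound′ b = ≤-trans (count-mono unchanged) (R-bound P b)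
      where
      unchanged : ∀ u → R u ∧ (col′ u ≡ᵇ b) ≡ true → R u ∧ (col u ≡ᵇ b) ≡ true
      unchanged u h with ∧-elim {R u} h
      ... | Ru , c = ∧-intro Ru (subst (λ x → ((if x then a else col u) ≡ᵇ b) ≡ true) (R≢y u Ru) c)

    D-bound′ : ∀ b → count (λ u → insert D y u ∧ (col′ u ≡ᵇ b)) ≤ 1
    D-bound′ b with a ≟ b
    ... | yes refl = ≤-trans (count-mono only-y) (≤-reflexive (count-== y))
      where
      only-y : ∀ u → insert D y u ∧ (col′ u ≡ᵇ a) ≡ true → (u == y) ≡ true
      only-y u h with u == y | ∧-elim {insert D y u} h
      ... | true  | _ = refl
      ... | false | Du∨⊥ , c = ⊥-elim (true≢false c (unused-on-D u (trans (sym (∨-identityʳ (D u))) Du∨⊥)))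
    ... | no a≢b = ≤-trans (count-mono old-class) (D-bound P b)
      where
      old-class : ∀ u → insert D y u ∧ (col′ u ≡ᵇ b) ≡ true → D u ∧ (col u ≡ᵇ b) ≡ true
      old-class u h with u == y | ∧-elim {insert D y u} h
      ... | true  | _ , c = ⊥-elim (true≢false c (≢⇒≡ᵇ-false a b a≢b))
      ... | false | Du∨⊥ , c = ∧-intro (trans (sym (∨-identityʳ (D u))) Du∨⊥) c

    forest′ : ∀ b → InducesForest G (λ u → (R u ∨ insert D y u) ∧ (col′ u ≡ᵇ b))
    forest′ b with a ≟ b
    ... | yes refl = InducesForest-⊆ G class-a+y (InducesForest-addLeaf G class-a y (forest P a) leaf)
      where
      class-a : Fin n → Bool
      class-a u = (R u ∨ D u) ∧ (col u ≡ᵇ a)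
      leaf : ∀ p q → adj G y p ≡ true → class-a p ≡ true → adj G y q ≡ true → class-a q ≡ true → p ≡ q
      leaf p q yp ap yq aq with ∧-elim {R p ∨ D p} ap | ∧-elim {R q ∨ D q} aq
      ... | Rp∨Dp , cp | Rq∨Dq , cq = atMostOne p q yp (in-R p Rp∨Dp cp) cp yq (in-R q Rq∨Dq cq) cq
        where
        in-R : ∀ u → R u ∨ D u ≡ true → (col u ≡ᵇ a) ≡ true → R u ≡ true
        in-R u RD c with ∨-elim {R u} RD
        ... | inj₁ Ru = Ru
        ... | inj₂ Du = ⊥-elim (true≢false c (unused-on-D u Du))
      class-a+y : ∀ u → (R u ∨ insert D y u) ∧ (col′ u ≡ᵇ a) ≡ true → insert class-a y u ≡ true
      class-a+y u h with u == y | ∧-elim {R u ∨ insert D y u} h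
      ... | true  | _ = ∨-introʳ {class-a u} refl
      ... | false | RD , c = ∨-introˡ (∧-intro (old u RD) c)
    ... | no a≢b = InducesForest-⊆ G old-class (forest P b)
      where
      old-class : ∀ u → (R u ∨ insert D y u) ∧ (col′ u ≡ᵇ b) ≡ true → (R u ∨ D u) ∧ (col u ≡ᵇ b) ≡ true
      old-class u h with u == y | ∧-elim {R u ∨ insert D y u} h
      ... | true  | _ , c = ⊥-elim (true≢false c (≢⇒≡ᵇ-false a b a≢b))
      ... | false | RD , c = ∧-intro (old u RD) c

    disjoint′ : ∀ u → R u ≡ true → insert D y u ≡ false
    disjoint′ u Ru = trans (cong (_∨ (u == y)) (disjoint P u Ru)) (R≢y u Ru)

  PartialColouring-cong : ∀ {D D′ col} → (∀ u → D u ≡ D′ u) → PartialColouring D col → PartialColouring D′ col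
  PartialColouring-cong {D} {D′} {col} D≗D′ P = record
    { inList   = λ u h → inList P u (subst (λ x → R u ∨ x ≡ true) (sym (D≗D′ u)) h)
    ; forest   = λ a → InducesForest-⊆ G (λ u → subst (λ x → (R u ∨ x) ∧ (col u ≡ᵇ a) ≡ true) (sym (D≗D′ u)))
                                        (forest P a)
    ; R-bound  = R-bound P
    ; D-bound  = λ a → ≤-trans (≤-reflexive (count-cong (λ u → cong (_∧ (col u ≡ᵇ a)) (sym (D≗D′ u)))))
                               (D-bound P a)
    ; disjoint = λ u Ru → trans (sym (D≗D′ u)) (disjoint P u Ru) }

  extend-along : ∀ ys D col → GreedyOrder G k R (count D) ys → Distinct ys →
                 (∀ z → (z ∈ᵇ ys) ≡ true → R z ≡ false × D z ≡ false) → PartialColouring D col →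
                 Σ (Fin n → ℕ) (PartialColouring (λ u → D u ∨ (u ∈ᵇ ys)))
  extend-along [] D col _ _ _ P = col , PartialColouring-cong (λ u → sym (∨-identityʳ (D u))) P
  extend-along (y ∷ ys) D col (slot , order) (y∉ys , distinct) fresh P
    with fresh y (∈ᵇ-here y ys)
  ... | Ry , Dy with extend-vertex D col y slot Ry Dy P
  ... | col₁ , P₁
    with extend-along ys (insert D y) col₁ (subst (λ t → GreedyOrder G k R t ys) (sym (count-insert D y Dy)) order)
                      distinct fresh′ P₁
    where
    fresh′ : ∀ z → (z ∈ᵇ ys) ≡ true → R z ≡ false × insert D y z ≡ false
    fresh′ z z∈ys with fresh z (∨-introʳ z∈ys) | z == y in e
    ... | Rz , Dz | true  = ⊥-elim (true≢false (subst (λ w → (w ∈ᵇ ys) ≡ true) (==⇒≡ z y e) z∈ys) y∉ys)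
    ... | Rz , Dz | false = Rz , trans (cong (_∨ false) Dz) refl
  ... | col₂ , P₂ = col₂ , PartialColouring-cong (λ u → ∨-assoc (D u) (u == y) (u ∈ᵇ ys)) P₂

module _ {n : ℕ} (G : Graph n) {k : ℕ} (LA : ListAssignment n k) where

  -- The colour classes of U meet U ∖ₗ S in at most β and S in at most one vertex.
  extend-colouring : ∀ U S β → Distinct S → S ⊆ˡ U →
                     GreedyOrder G k (U ∖ₗ S) 0 S → Colouring G LA (U ∖ₗ S) β → Colouring G LA U (suc β)
  extend-colouring U S β distinct _ order C = record
    { colour = col ; inList = inList′ ; forest = forest′ ; bound = bound′ }
    where
    R = U ∖ₗ S
    P₀ : PartialColouring G LA R β (λ _ → false) (Colouring.colour C)
    P₀ = record
      { inList   = λ u h → Colouring.inList C u (trans (sym (∨-identityʳ (R u))) h)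
      ; forest   = λ a → InducesForest-⊆ G (λ u → subst (λ x → x ∧ _ ≡ true) (∨-identityʳ (R u)))
                                          (Colouring.forest C a)
      ; R-bound  = Colouring.bound C
      ; D-bound  = λ a → ≤-trans (≤-reflexive (count-false {n})) z≤n
      ; disjoint = λ _ _ → refl }
    fresh : ∀ z → (z ∈ᵇ S) ≡ true → R z ≡ false × false ≡ false
    fresh z z∈S rewrite z∈S = ∧-zeroʳ (U z) , refl
    extended = extend-along G LA R β S (λ _ → false) (Colouring.colour C)
                 (subst (λ t → GreedyOrder G k R t S) (sym (count-false {n})) order) distinct fresh P₀
    col = proj₁ extended
    P = proj₂ extended
    covered : ∀ u → U u ≡ true → R u ∨ (u ∈ᵇ S) ≡ true
    covered u Uu with u ∈ᵇ S
    ... | true  = ∨-zeroʳ (U u ∧ false)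
    ... | false = ∨-introˡ (trans (∧-identityʳ (U u)) Uu)
    inList′ : ∀ u → U u ≡ true → col u ∈ proj₁ LA u
    inList′ u Uu = PartialColouring.inList P u (covered u Uu)
    forest′ : ∀ a → InducesForest G (λ u → U u ∧ (col u ≡ᵇ a))
    forest′ a = InducesForest-⊆ G (λ u h → ∧-intro (covered u (proj₁ (∧-elim {U u} h))) (proj₂ (∧-elim {U u} h)))
                                (PartialColouring.forest P a)
    bound′ : ∀ a → count (λ u → U u ∧ (col u ≡ᵇ a)) ≤ suc β
    bound′ a = begin
      count (λ u → U u ∧ (col u ≡ᵇ a))
        ≤⟨ count-mono split ⟩
      count (λ u → (R u ∧ (col u ≡ᵇ a)) ∨ ((u ∈ᵇ S) ∧ (col u ≡ᵇ a)))
        ≤⟨ count-∨ (λ u → R u ∧ (col u ≡ᵇ a)) (λ u → (u ∈ᵇ S) ∧ (col u ≡ᵇ a)) ⟩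
      count (λ u → R u ∧ (col u ≡ᵇ a)) + count (λ u → (u ∈ᵇ S) ∧ (col u ≡ᵇ a))
        ≤⟨ +-mono-≤ (PartialColouring.R-bound P a) (PartialColouring.D-bound P a) ⟩
      β + 1
        ≡⟨ +-comm β 1 ⟩
      suc β ∎
      where
      open ≤-Reasoning
      split : ∀ u → U u ∧ (col u ≡ᵇ a) ≡ true →
              (R u ∧ (col u ≡ᵇ a)) ∨ ((u ∈ᵇ S) ∧ (col u ≡ᵇ a)) ≡ true
      split u h with ∧-elim {U u} h
      ... | Uu , c with ∨-elim {R u} (covered u Uu)
      ... | inj₁ Ru  = ∨-introˡ (∧-intro Ru c)
      ... | inj₂ u∈S = ∨-introʳ {R u ∧ _} (∧-intro u∈S c)

  Colouring-weaken : ∀ {X β β′} → β ≤ β′ → Colouring G LA X β → Colouring G LA X β′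
  Colouring-weaken β≤β′ C =
    record { colour = colour ; inList = inList ; forest = forest ; bound = λ a → ≤-trans (bound a) β≤β′ }
    where open Colouring C

  emptyColouring : ∀ {X} → count X ≡ 0 → Colouring G LA X 0
  emptyColouring {X} none = record
    { colour = λ _ → 0
    ; inList = λ u Xu → ⊥-elim (true≢false Xu (count≡0⇒false X none u))
    ; forest = λ a C → true≢false (proj₁ (∧-elim (CycleIn.inS C zero))) (count≡0⇒false X none _)
    ; bound  = λ a → ≤-trans (count-mono (λ u h → proj₁ (∧-elim {X u} h))) (≤-reflexive none) }

-- Low-degree vertices and claw-freeness

module _ {n : ℕ} (G : Graph n) where

  induced : (Fin n → Bool) → Subgraph G
  induced X = record
    { S     = X
    ; E     = λ u v → X u ∧ (X v ∧ adj G u v)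
    ; E-sym = symmetric
    ; E⊆G   = λ u v h → proj₂ (∧-elim {X v} (proj₂ (∧-elim {X u} h)))
    ; E⊆S   = λ u v h → proj₁ (∧-elim {X u} h) }
    where
    symmetric : ∀ u v → X u ∧ (X v ∧ adj G u v) ≡ X v ∧ (X u ∧ adj G v u)
    symmetric u v rewrite adj-sym G u v with X u | X v
    ... | true  | true  = refl
    ... | true  | false = refl
    ... | false | true  = refl
    ... | false | false = refl

  lowDegreeVertex : ∀ {d} → Degenerate d G → ∀ X → 1 ≤ count X →
                    Σ (Fin n) λ w → X w ≡ true × degreeIn G X w ≤ d
  lowDegreeVertex degenerate X nonempty with degenerate (induced X) (count>0⇒∃ X nonempty)
  ... | w , Xw , low = w , Xw , ≤-trans (count-mono inducedEdge) low
    where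
    inducedEdge : ∀ u → adj G w u ∧ X u ≡ true → X w ∧ (X u ∧ adj G w u) ≡ true
    inducedEdge u h = ∧-intro Xw (∧-intro (proj₂ (∧-elim {adj G w u} h)) (proj₁ (∧-elim {adj G w u} h)))

  record LowDegreeSequence (d : ℕ) (X : Fin n → Bool) (fs : List (Fin n)) : Set where
    field
      distinct  : Distinct fs
      inside    : fs ⊆ˡ X
      lowDegree : ∀ z → (z ∈ᵇ fs) ≡ true → degreeIn G (X ∖ₗ fs) z ≤ d

  lowDegreeSequence : ∀ {d} → Degenerate d G → ∀ j X → j ≤ count X →
                      Σ (List (Fin n)) λ fs → length fs ≡ j × LowDegreeSequence d X fs
  lowDegreeSequence degenerate zero X _ = [] , refl , record { distinct = tt ; inside = λ _ () ; lowDegree = λ _ () }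
  lowDegreeSequence {d} degenerate (suc j) X j<count
    with lowDegreeVertex degenerate X (≤-trans (s≤s z≤n) j<count)
  ... | w , Xw , w-low
    with lowDegreeSequence degenerate j (X ∖ w) (s≤s⁻¹ (≤-trans j<count (≤-reflexive (count-∖ X w Xw))))
  ... | fs , refl , F = w ∷ fs , refl , record { distinct = w∉fs , distinct F ; inside = inside′ ; lowDegree = lowDegree′ }
    where
    open LowDegreeSequence
    w∉fs : (w ∈ᵇ fs) ≡ false
    w∉fs with w ∈ᵇ fs in e
    ... | false = refl
    ... | true  = ⊥-elim (true≢false (proj₂ (∧-elim {X w} (inside F w e))) (cong not (==-refl w)))
    inside′ : (w ∷ fs) ⊆ˡ X
    inside′ z m with ∨-elim {z == w} m
    ... | inj₁ z=w = subst (λ q → X q ≡ true) (sym (==⇒≡ z w z=w)) Xw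
    ... | inj₂ z∈fs = proj₁ (∧-elim {X z} (inside F z z∈fs))
    lowDegree′ : ∀ z → (z ∈ᵇ (w ∷ fs)) ≡ true → degreeIn G (X ∖ₗ (w ∷ fs)) z ≤ d
    lowDegree′ z m with ∨-elim {z == w} m
    ... | inj₁ z=w rewrite ==⇒≡ z w z=w = ≤-trans (degreeIn-mono G (λ u h → proj₁ (∧-elim {X u} h)) w) w-low
    ... | inj₂ z∈fs = ≤-trans (degreeIn-mono G (λ u h → trans (sym (∖ₗ-∷ X w fs u)) h) z) (lowDegree F z z∈fs)

  clawFree-edge : ClawFree G → ∀ v (N : Fin n → Bool) → (∀ u → N u ≡ true → adj G v u ≡ true) →
                  3 ≤ count N →
                  Σ (Fin n) λ x → Σ (Fin n) λ y → N x ≡ true × N y ≡ true × x ≢ y × adj G x y ≡ true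
  clawFree-edge clawFree v N N⊆Nv three = edge
    where
    pick-a = count>0⇒∃ N (≤-trans (s≤s z≤n) three)
    a = proj₁ pick-a
    two : 2 ≤ count (N ∖ a)
    two = s≤s⁻¹ (≤-trans three (≤-reflexive (count-∖ N a (proj₂ pick-a))))
    pick-b = count>0⇒∃ (N ∖ a) (≤-trans (s≤s z≤n) two)
    b = proj₁ pick-b
    pick-c = count>0⇒∃ ((N ∖ a) ∖ b) (s≤s⁻¹ (≤-trans two (≤-reflexive (count-∖ (N ∖ a) b (proj₂ pick-b)))))
    c = proj₁ pick-c
    Na = proj₂ pick-a
    Nb = ∖-elim N b a (proj₂ pick-b)
    Nc₁ = ∖-elim (N ∖ a) c b (proj₂ pick-c)
    Nc = ∖-elim N c a (proj₁ Nc₁)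
    edge : Σ (Fin n) λ x → Σ (Fin n) λ y → N x ≡ true × N y ≡ true × x ≢ y × adj G x y ≡ true
    edge with adj G a b in ab | adj G a c in ac | adj G b c in bc
    ... | true  | _     | _     = a , b , Na , proj₁ Nb , (λ e → proj₂ Nb (sym e)) , ab
    ... | false | true  | _     = a , c , Na , proj₁ Nc , (λ e → proj₂ Nc (sym e)) , ac
    ... | false | false | true  = b , c , proj₁ Nb , proj₁ Nc , (λ e → proj₂ Nc₁ (sym e)) , bc
    ... | false | false | false = ⊥-elim (clawFree (v , a , b , c , N⊆Nv a Na , N⊆Nv b (proj₁ Nb) , N⊆Nv c (proj₁ Nc) ,
            (λ e → proj₂ Nb (sym e)) , (λ e → proj₂ Nc (sym e)) , (λ e → proj₂ Nc₁ (sym e)) , ab , ac , bc))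

-- Blocks of k vertices

module Blocks {n : ℕ} (G : Graph n) (degenerate : Degenerate 3 G) (clawFree : ClawFree G)
              (k′ : ℕ) (Δ<2k : Δ G < (3 + k′) + (3 + k′)) where

  k : ℕ
  k = 3 + k′

  record Block (U : Fin n → Bool) (S : List (Fin n)) : Set where
    field
      distinct : Distinct S
      inside   : S ⊆ˡ U
      size     : length S ≡ k
      order    : GreedyOrder G k (U ∖ₗ S) 0 S

  -- The block is pre ++ fs ++ [v] with fs a low-degree sequence of U ∖ₗ (v ∷ pre): the vertices
  -- of pre are handled by the caller, the fillers have degree at most 3, and v comes last.
  completeBlock : ∀ U v pre j → k ≤ count U → U v ≡ true → length pre + suc j ≡ k → Distinct (v ∷ pre) →
                  pre ⊆ˡ U → GreedyOrder G k (U ∖ₗ (v ∷ pre)) 0 pre → degreeIn G (U ∖ₗ (v ∷ pre)) v ≤ 1 →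
                  Σ (List (Fin n)) (Block U)
  completeBlock U v pre j big Uv sizes (v∉pre , distinct-pre) pre⊆U pre-order v-low
    with lowDegreeSequence G degenerate j (U ∖ₗ (v ∷ pre)) j≤count
    where
    v∷pre⊆U : (v ∷ pre) ⊆ˡ U
    v∷pre⊆U z m with ∨-elim {z == v} m
    ... | inj₁ z=v  = subst (λ q → U q ≡ true) (sym (==⇒≡ z v z=v)) Uv
    ... | inj₂ z∈pre = pre⊆U z z∈pre
    j≤count : j ≤ count (U ∖ₗ (v ∷ pre))
    j≤count = +-cancelʳ-≤ (suc (length pre)) j _ (begin
      j + suc (length pre)                     ≡⟨ +-suc-comm j (length pre) ⟩
      length pre + suc j                       ≡⟨ sizes ⟩
      k                                        ≤⟨ big ⟩
      count U                                  ≡⟨ sym (count-∖ₗ U (v ∷ pre) (v∉pre , distinct-pre) v∷pre⊆U) ⟩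
      count (U ∖ₗ (v ∷ pre)) + suc (length pre) ∎)
      where
      open ≤-Reasoning
      +-suc-comm : ∀ j p → j + suc p ≡ p + suc j
      +-suc-comm = solve-∀
  ... | fs , refl , F = B , record { distinct = distinct ; inside = inside ; size = size ; order = order }
    where
    open LowDegreeSequence F using (lowDegree) renaming (distinct to distinct-fs; inside to fs⊆X)
    X = U ∖ₗ (v ∷ pre)
    B = pre ++ (fs ++ (v ∷ []))
    R = U ∖ₗ B

    fs-outside : ∀ u → (u ∈ᵇ fs) ≡ true → (u == v) ≡ false × (u ∈ᵇ pre) ≡ false
    fs-outside u u∈fs with ∧-elim {U u} (fs⊆X u u∈fs)
    ... | _ , u∉v∷pre with u == v | u ∈ᵇ pre
    ... | false | false = refl , refl
    ... | false | true  = ⊥-elim (true≢false refl (sym u∉v∷pre))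
    ... | true  | _     = ⊥-elim (true≢false refl (sym u∉v∷pre))

    distinct : Distinct B
    distinct = Distinct-++ pre (fs ++ (v ∷ [])) distinct-pre
      (Distinct-++ fs (v ∷ []) distinct-fs (refl , tt)
        (λ u u∈fs → trans (cong (_∨ false) (proj₁ (fs-outside u u∈fs))) refl))
      pre∌
      where
      pre∌ : ∀ u → (u ∈ᵇ pre) ≡ true → (u ∈ᵇ (fs ++ (v ∷ []))) ≡ false
      pre∌ u u∈pre with u ∈ᵇ (fs ++ (v ∷ [])) in e
      ... | false = refl
      ... | true with ∨-elim {u ∈ᵇ fs} (trans (sym (∈ᵇ-++ u fs (v ∷ []))) e)
      ... | inj₁ u∈fs = ⊥-elim (true≢false u∈pre (proj₂ (fs-outside u u∈fs)))
      ... | inj₂ u∈[v] =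
        ⊥-elim (true≢false u∈pre (subst (λ w → (w ∈ᵇ pre) ≡ false) (sym (∈ᵇ-singleton u∈[v])) v∉pre))

    inside : B ⊆ˡ U
    inside u u∈B with ∨-elim {u ∈ᵇ pre} (trans (sym (∈ᵇ-++ u pre _)) u∈B)
    ... | inj₁ u∈pre = pre⊆U u u∈pre
    ... | inj₂ u∈fs∷v with ∨-elim {u ∈ᵇ fs} (trans (sym (∈ᵇ-++ u fs _)) u∈fs∷v)
    ... | inj₁ u∈fs = proj₁ (∧-elim {U u} (fs⊆X u u∈fs))
    ... | inj₂ u∈[v] = subst (λ w → U w ≡ true) (sym (∈ᵇ-singleton u∈[v])) Uv

    size : length B ≡ k
    size = begin
      length B                               ≡⟨ length-++ pre ⟩
      length pre + length (fs ++ (v ∷ []))   ≡⟨ cong (length pre +_) (length-++ fs) ⟩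
      length pre + (length fs + 1)           ≡⟨ cong (length pre +_) (+-comm (length fs) 1) ⟩
      length pre + suc (length fs)           ≡⟨ sizes ⟩
      k                                      ∎
      where open ≡-Reasoning

    v∷pre++fs⊆B : ((v ∷ pre) ++ fs) ⊆ₗ B
    v∷pre++fs⊆B u m with ∨-elim {u == v} m
    ... | inj₁ u=v = ∈ᵇ-++⁺ʳ pre _ (∈ᵇ-++⁺ʳ fs (v ∷ []) (∨-introˡ u=v))
    ... | inj₂ m′ with ∨-elim {u ∈ᵇ pre} (trans (sym (∈ᵇ-++ u pre fs)) m′)
    ... | inj₁ u∈pre = ∈ᵇ-++⁺ˡ pre _ u∈pre
    ... | inj₂ u∈fs  = ∈ᵇ-++⁺ʳ pre _ (∈ᵇ-++⁺ˡ fs (v ∷ []) u∈fs)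

    R⊆X∖fs : ∀ u → R u ≡ true → (X ∖ₗ fs) u ≡ true
    R⊆X∖fs u h =
      trans (∖ₗ-++ U (v ∷ pre) fs u) (∖ₗ-⊆ {X = U} {X′ = U} B ((v ∷ pre) ++ fs) (λ _ Uu → Uu) v∷pre++fs⊆B u h)

    R⊆X : ∀ u → R u ≡ true → X u ≡ true
    R⊆X u h = proj₁ (∧-elim {X u} (R⊆X∖fs u h))

    order : GreedyOrder G k R 0 B
    order = GreedyOrder-++ G k R 0 pre (fs ++ (v ∷ [])) (GreedyOrder-⊆ G k R⊆X 0 pre pre-order)
              (GreedyOrder-++ G k R (length pre) fs (v ∷ [])
                (GreedyOrder-⊆ G k R⊆X∖fs (length pre) fs
                  (GreedyOrder-lowDegree G k (X ∖ₗ fs) fs (length pre) lowDegree fillers-fit))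
                (v-slot , tt))
      where
      t = length pre + length fs
      t+1≡k : t + 1 ≡ k
      t+1≡k = trans (+-assoc (length pre) (length fs) 1) (trans (cong (length pre +_) (+-comm (length fs) 1)) sizes)
      fillers-fit : length pre + length fs < k
      fillers-fit = ≤-reflexive (trans (+-comm 1 t) t+1≡k)
      v-slot : t + t + degreeIn G R v < k + k
      v-slot = begin-strict
        t + t + degreeIn G R v ≤⟨ +-monoʳ-≤ (t + t) (≤-trans (degreeIn-mono G R⊆X v) v-low) ⟩
        t + t + 1              <⟨ ≤-reflexive (double-+1 t) ⟩
        (t + 1) + (t + 1)      ≡⟨ cong₂ _+_ t+1≡k t+1≡k ⟩
        k + k                  ∎
        where
        open ≤-Reasoning
        double-+1 : ∀ t → suc (t + t + 1) ≡ (t + 1) + (t + 1)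
        double-+1 = solve-∀

  Δ-slot : ∀ R y → 0 + 0 + degreeIn G R y < k + k
  Δ-slot R y = ≤-<-trans (degreeIn≤Δ G R y) Δ<2k

  private
    N : (Fin n → Bool) → Fin n → Fin n → Bool
    N U v u = adj G v u ∧ U u

  blockAroundLeaf : ∀ U v → k ≤ count U → U v ≡ true → degreeIn G U v ≤ 1 → Σ (List (Fin n)) (Block U)
  blockAroundLeaf U v big Uv ≤1 = completeBlock U v [] (2 + k′) big Uv refl (refl , tt) (λ _ ()) tt
    (≤-trans (degreeIn-mono G (λ u h → proj₁ (∧-elim {U u} h)) v) ≤1)

  blockAroundPath : ∀ U v a → k ≤ count U → U v ≡ true → N U v a ≡ true → degreeIn G U v ≤ 2 →
                    Σ (List (Fin n)) (Block U)
  blockAroundPath U v a big Uv Na ≤2 = completeBlock U v (a ∷ []) (1 + k′) big Uv refl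
    (trans (cong (_∨ false) (≢⇒==-false v a (adj⇒≢ G va))) refl , refl , tt)
    (λ u m → subst (λ w → U w ≡ true) (sym (∈ᵇ-singleton m)) Ua) (Δ-slot _ a , tt) v-rest
    where
    va = proj₁ (∧-elim {adj G v a} Na)
    Ua = proj₂ (∧-elim {adj G v a} Na)
    v-rest : degreeIn G (U ∖ₗ (v ∷ a ∷ [])) v ≤ 1
    v-rest = +-cancelʳ-≤ 1 _ 1 (≤-trans
      (degreeIn-avoiding G (a ∷ []) v (refl , tt)
        (λ u m → subst (λ w → N U v w ≡ true) (sym (∈ᵇ-singleton m)) Na)
        (∖ₗ-⊆ (v ∷ a ∷ []) (a ∷ []) (λ _ Uu → Uu) (λ u m → ∨-introʳ {u == v} m)))
      ≤2)

  blockAroundTriangle : ∀ U v x y → k ≤ count U → U v ≡ true → N U v x ≡ true → N U v y ≡ true → x ≢ y →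
                        adj G x y ≡ true → degreeIn G U v ≤ 3 → Σ (List (Fin n)) (Block U)
  blockAroundTriangle U v x y big Uv Nx Ny x≢y xy ≤3 = completeBlock U v (x ∷ y ∷ []) k′ big Uv refl
    distinct pre⊆U (Δ-slot _ x , y-slot , tt) v-rest
    where
    vx = proj₁ (∧-elim {adj G v x} Nx)
    vy = proj₁ (∧-elim {adj G v y} Ny)
    distinct : Distinct (v ∷ x ∷ y ∷ [])
    distinct = cong₂ _∨_ (≢⇒==-false v x (adj⇒≢ G vx)) (cong (_∨ false) (≢⇒==-false v y (adj⇒≢ G vy))) ,
               cong (_∨ false) (≢⇒==-false x y x≢y) , refl , tt
    pre⊆U : (x ∷ y ∷ []) ⊆ˡ U
    pre⊆U u m with ∨-elim {u == x} m
    ... | inj₁ u=x = subst (λ w → U w ≡ true) (sym (==⇒≡ u x u=x)) (proj₂ (∧-elim {adj G v x} Nx))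
    ... | inj₂ u∈[y] = subst (λ w → U w ≡ true) (sym (∈ᵇ-singleton u∈[y])) (proj₂ (∧-elim {adj G v y} Ny))
    y-slot : 1 + 1 + degreeIn G (U ∖ₗ (v ∷ x ∷ y ∷ [])) y < k + k
    y-slot = ≤-<-trans (≤-trans (≤-reflexive (+-comm 2 _))
      (≤-trans (degreeIn-avoiding G (v ∷ x ∷ []) y (cong (_∨ false) (≢⇒==-false v x (adj⇒≢ G vx)) , refl , tt)
                  v,x-adj (∖ₗ-⊆ (v ∷ x ∷ y ∷ []) (v ∷ x ∷ []) (λ _ _ → refl) v,x⊆v,x,y))
               (degreeIn≤Δ G _ y))) Δ<2k
      where
      v,x⊆v,x,y : (v ∷ x ∷ []) ⊆ₗ (v ∷ x ∷ y ∷ [])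
      v,x⊆v,x,y u = ∈ᵇ-++⁺ˡ {u = u} (v ∷ x ∷ []) (y ∷ [])
      v,x-adj : (v ∷ x ∷ []) ⊆ˡ (λ u → adj G y u ∧ true)
      v,x-adj u m with ∨-elim {u == v} m
      ... | inj₁ u=v = subst (λ w → adj G y w ∧ true ≡ true) (sym (==⇒≡ u v u=v)) (∧-intro (adj-flip G vy) refl)
      ... | inj₂ u∈[x] =
        subst (λ w → adj G y w ∧ true ≡ true) (sym (∈ᵇ-singleton u∈[x])) (∧-intro (adj-flip G xy) refl)
    v-rest : degreeIn G (U ∖ₗ (v ∷ x ∷ y ∷ [])) v ≤ 1
    v-rest = +-cancelʳ-≤ 2 _ 1 (≤-trans
      (degreeIn-avoiding G (x ∷ y ∷ []) v (cong (_∨ false) (≢⇒==-false x y x≢y) , refl , tt) x,y-adj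
        (∖ₗ-⊆ (v ∷ x ∷ y ∷ []) (x ∷ y ∷ []) (λ _ Uu → Uu) (λ u m → ∨-introʳ {u == v} m)))
      ≤3)
      where
      x,y-adj : (x ∷ y ∷ []) ⊆ˡ N U v
      x,y-adj u m with ∨-elim {u == x} m
      ... | inj₁ u=x = subst (λ w → N U v w ≡ true) (sym (==⇒≡ u x u=x)) Nx
      ... | inj₂ u∈[y] = subst (λ w → N U v w ≡ true) (sym (∈ᵇ-singleton u∈[y])) Ny

  -- A vertex v of degree at most 3 in U has at most one U-neighbour, exactly two, or three
  -- among which claw-freeness finds an edge.
  selectBlock : ∀ U → k ≤ count U → Σ (List (Fin n)) (Block U)
  selectBlock U big with lowDegreeVertex G degenerate U (≤-trans (s≤s z≤n) big)
  ... | v , Uv , ≤3 with degreeIn G U v ≤? 1 | degreeIn G U v ≤? 2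
  ... | yes ≤1 | _      = blockAroundLeaf U v big Uv ≤1
  ... | no >1  | yes ≤2 =
    let (a , Na) = count>0⇒∃ (N U v) (≤-trans (s≤s z≤n) (≰⇒> >1)) in blockAroundPath U v a big Uv Na ≤2
  ... | no _   | no >2  =
    let (x , y , Nx , Ny , x≢y , xy) =
          clawFree-edge G clawFree v (N U v) (λ u h → proj₁ (∧-elim {adj G v u} h)) (≰⇒> >2)
    in blockAroundTriangle U v x y big Uv Nx Ny x≢y xy ≤3

module Colourings {n : ℕ} (G : Graph n) (degenerate : Degenerate 3 G) (clawFree : ClawFree G)
                  (k′ : ℕ) (Δ<2k : Δ G < (3 + k′) + (3 + k′)) (LA : ListAssignment n (3 + k′)) where

  open Blocks G degenerate clawFree k′ Δ<2k

  -- With fewer than k vertices, all of U forms a single block.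
  colourSmall : ∀ m U → count U ≡ suc m → suc m < k → Colouring G LA U 1
  colourSmall m U size small
    with lowDegreeSequence G degenerate (suc m) U (≤-reflexive (sym size))
  ... | fs , len , F = extend-colouring G LA U fs 0 distinct inside order (emptyColouring G LA rest-empty)
    where
    open LowDegreeSequence F
    rest-empty : count (U ∖ₗ fs) ≡ 0
    rest-empty = +-cancelʳ-≡ (suc m) _ 0
      (trans (cong (count (U ∖ₗ fs) +_) (sym len)) (trans (count-∖ₗ U fs distinct inside) size))
    order : GreedyOrder G k (U ∖ₗ fs) 0 fs
    order = GreedyOrder-lowDegree G k (U ∖ₗ fs) fs 0 lowDegree (subst (_< k) (sym len) small)

  colourAll : ∀ m U → count U ≡ m → Colouring G LA U (ceilDiv m k)
  colourAll = <-rec (λ m → ∀ U → count U ≡ m → Colouring G LA U (ceilDiv m k)) step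
    where
    step : ∀ m → (∀ {m′} → m′ < m → ∀ U → count U ≡ m′ → Colouring G LA U (ceilDiv m′ k)) →
           ∀ U → count U ≡ m → Colouring G LA U (ceilDiv m k)
    step zero    _   U none = Colouring-weaken G LA z≤n (emptyColouring G LA none)
    step (suc m) rec U count≡m with k ≤? suc m
    ... | no small = Colouring-weaken G LA (ceilDiv-pos m (2 + k′)) (colourSmall m U count≡m (≰⇒> small))
    ... | yes big with selectBlock U (subst (k ≤_) (sym count≡m) big)
    ... | B , block = subst (Colouring G LA U) ceil-eq
          (extend-colouring G LA U B _ distinct inside order (rec rest<m (U ∖ₗ B) refl))
      where
      open Block block
      rest+k : count (U ∖ₗ B) + k ≡ suc m
      rest+k = trans (cong (count (U ∖ₗ B) +_) (sym size)) (trans (count-∖ₗ U B distinct inside) count≡m)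
      rest<m : count (U ∖ₗ B) < suc m
      rest<m = subst (count (U ∖ₗ B) <_) rest+k (m<m+n _ (s≤s z≤n))
      ceil-eq : suc (ceilDiv (count (U ∖ₗ B)) k) ≡ ceilDiv (suc m) k
      ceil-eq = trans (sym (ceilDiv-+-self (count (U ∖ₗ B)) (2 + k′))) (cong (λ c → ceilDiv c k) rest+k)

theorem3 : ∀ {n} (G : Graph n) → Degenerate 3 G → ClawFree G →
    (k : ℕ) → ⌈ suc (Δ G) /2⌉ ⊔ 3 ≤ k → EquitableListPointArborable G k
theorem3 {n} G degenerate clawFree k k-large with ≤-trans (m≤n⊔m ⌈ suc (Δ G) /2⌉ 3) k-large
... | s≤s (s≤s (s≤s {n = k′} _)) = λ LA →
  let open Colouring (Colourings.colourAll G degenerate clawFree k′ Δ<2k LA n (λ _ → true) count-true)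
  in colour , (λ v → inList v refl) , forest , bound
  where
  Δ<2k : Δ G < k + k
  Δ<2k = ⌈n/2⌉≤k⇒n≤k+k (≤-trans (m≤m⊔n ⌈ suc (Δ G) /2⌉ 3) k-large)
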